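{- Let $e$ be an even positive integer, $q=2^e$, $d=(q^2+q+1)/3$, $\sigma(X)=X+X^d+X^{dq}$ (a permutation polynomial of $\mathbb{F}_{q^2}$), and for $\alpha\in\mathbb{F}_q^*$ let $f_\alpha(x)=\operatorname{Tr}_{q^2}(\alpha(\sigma^{ -1}(x))^3)$. Let $u$ be a generator of the cyclic group $\mu_{q+1}$ and define $g_\alpha:\mathbb{F}_{q^2}\to\mathbb{F}_2$ by $g_\alpha(0)=0$ and $$g_\alpha(x)=\operatorname{Tr}_{q^2}\!\left(\alpha\,\frac{u^{6i}}{(1+u^{2i}+u^{ -2i})^3}x^3\right)\quad\text{for }x\in u^i\mathbb{F}_q^*,\ 0\le i\le q.$$ Then for every $z\in\mu_{q+1}$ and every $x\in z\mathbb{F}_q^*$ one has $\sigma^{ -1}(x)=\frac{z^2}{1+z^2+z^{ -2}}x$. In particular, $g_\alpha(x)=f_\alpha(x)$ for all $x\in\mathbb{F}_{q^2}$.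
   Context: $\mu_{q+1}=\{z\in\mathbb{F}_{q^2}^*:z^{q+1}=1\}$; $\operatorname{Tr}_{q^2}$ is the absolute trace from $\mathbb{F}_{q^2}$ to $\mathbb{F}_2$; every $x\in\mathbb{F}_{q^2}^*$ lies in exactly one coset $u^i\mathbb{F}_q^*$ with $0\le i\le q$. -}

module Defs where

open import Level using (0ℓ)
open import Data.Nat as ℕ using (ℕ; zero; suc; _≤_)
open import Data.Nat.DivMod using (_/_)
open import Data.Fin using (Fin)
open import Data.Product using (Σ; _×_; ∃)
open import Relation.Binary.PropositionalEquality using (_≡_; _≢_)
open import Algebra.Structures using (IsCommutativeRing)
open import Function.Bundles using (_↔_)

-- A finite field, with propositional equality as its equality.
-- x ⁻¹ is the multiplicative inverse for x ≠ 0 (its value at 0 is irrelevant).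
record FiniteField : Set₁ where
  infixl 6 _+_
  infixl 7 _*_
  field
    Carrier           : Set
    _+_ _*_           : Carrier → Carrier → Carrier
    -_                : Carrier → Carrier
    0# 1#             : Carrier
    isCommutativeRing : IsCommutativeRing _≡_ _+_ _*_ -_ 0# 1#
    _⁻¹               : Carrier → Carrier
    0≢1               : 0# ≢ 1#
    inverseʳ          : ∀ x → x ≢ 0# → x * (x ⁻¹) ≡ 1#
    size              : ℕ
    enumeration       : Carrier ↔ Fin size

  infixr 8 _^_
  _^_ : Carrier → ℕ → Carrier
  x ^ zero  = 1#
  x ^ suc n = x * (x ^ n)

  infixl 7 _÷_
  _÷_ : Carrier → Carrier → Carrier
  x ÷ y = x * (y ⁻¹)

module Setting (e : ℕ) (F : FiniteField) where
  open FiniteField F public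

  q : ℕ
  q = 2 ℕ.^ e

  d : ℕ
  d = (q ℕ.* q ℕ.+ q ℕ.+ 1) / 3

  -- absolute trace F_{q^2} → F_2 (valued in the prime subfield {0,1} of F):
  -- Tr(x) = Σ_{j < 2e} x^(2^j)
  traceSum : ℕ → Carrier → Carrier
  traceSum zero    x = 0#
  traceSum (suc j) x = traceSum j x + x ^ (2 ℕ.^ j)

  Tr : Carrier → Carrier
  Tr x = traceSum (2 ℕ.* e) x

  σ : Carrier → Carrier
  σ x = x + x ^ d + x ^ (d ℕ.* q)

  InFqStar : Carrier → Set
  InFqStar t = (t ^ q ≡ t) × (t ≢ 0#)

  InMu : Carrier → Set
  InMu z = z ^ (q ℕ.+ 1) ≡ 1#

  IsGenerator : Carrier → Set
  IsGenerator u = InMu u × (∀ z → InMu z → ∃ λ k → z ≡ u ^ k)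

  IsInverseOfσ : (Carrier → Carrier) → Set
  IsInverseOfσ τ = (∀ y → τ (σ y) ≡ y) × (∀ x → σ (τ x) ≡ x)

  f : (Carrier → Carrier) → Carrier → Carrier → Carrier
  f τ α x = Tr (α * (τ x) ^ 3)

  -- g is the function g_α of the paper: g(0) = 0 and, for x ∈ u^i F_q^* with 0 ≤ i ≤ q,
  -- g(x) = Tr(α u^{6i} / (1 + u^{2i} + u^{-2i})^3 · x^3).
  -- (Every nonzero x lies in exactly one such coset, so this determines g.)
  IsG : Carrier → Carrier → (Carrier → Carrier) → Set
  IsG u α g =
    (g 0# ≡ 0#) ×
    (∀ (i : ℕ) → i ≤ q → ∀ t → InFqStar t →
       g (u ^ i * t) ≡
       Tr (α * (u ^ (6 ℕ.* i) ÷ (1# + u ^ (2 ℕ.* i) + (u ^ (2 ℕ.* i)) ⁻¹) ^ 3) * (u ^ i * t) ^ 3))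

{-# OPTIONS --safe #-}
-- Every x ≠ 0 factors as x = z t with z ∈ μ_{q+1} and t ∈ F_q^*.  Since q ≡ 1 (mod 3), the exponent d
-- is ≡ 1 modulo q - 1 while 3d ≡ 1 modulo q + 1, so σ(z³ t) = z³ t + z t + z⁻¹ t = z t s with
-- s = 1 + z² + z⁻².  Frobenius fixes s, so s ∈ F_q; and s ≠ 0, for otherwise w = z² would satisfy
-- w² + w + 1 = 0, hence w³ = 1 = w^{q+1}, hence w = 1 (as 3 ∤ q + 1) and s = 3 = 1.  Therefore
-- σ(z³ t / s) = z t, i.e. σ⁻¹(z t) = (z² / s) z t, and cubing this gives g_α = f_α coset by coset.
-- Characteristic 2 and x^{q²} = x both come from x^{|F|} = x.
module Submission where

open import Defs
open import Level using (0ℓ)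
open import Algebra.Bundles using (CommutativeRing)
import Algebra.Properties.CommutativeMonoid.Sum
open import Algebra.Solver.Ring.AlmostCommutativeRing using (_-Raw-AlmostCommutative⟶_; fromCommutativeRing)
open import Data.Bool as Bool using (Bool; true; false; if_then_else_)
open import Data.Bool.Properties using (xor-∧-commutativeRing)
open import Data.Fin as Fin using (Fin; zero; suc)
open import Data.Fin.Permutation using (Permutation)
open import Data.Fin.Properties using (punchInᵢ≢i; nonZeroIndex)
import Data.Maybe as Maybe
open import Data.Nat as ℕ using (ℕ; zero; suc; NonZero)
import Data.Nat.Properties as ℕ
open import Data.Nat.Divisibility using (_∣_; divides; ∣m⇒∣m*n)
open import Data.Nat.DivMod using (_/_; _%_; m*n/n≡m; m≡m%n+[m/n]*n; m%n<n)
open import Data.Product using (_×_; _,_; ∃; ∃₂; proj₁; proj₂)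
open import Data.Vec.Functional using (replicate; removeAt)
open import Function using (_∘_; case_of_; Inverse; _↔_; mk↔ₛ′)
open import Function.Construct.Composition using (_↔-∘_)
open import Function.Construct.Symmetry using (↔-sym)
open import Function.Properties.Inverse using (↔⇒↣)
open import Relation.Binary.Consequences using (dec⇒weaklyDec)
open import Relation.Binary.Definitions using (DecidableEquality; WeaklyDecidable)
open import Relation.Binary.PropositionalEquality
  using (_≡_; _≢_; refl; sym; trans; cong; cong₂; subst; module ≡-Reasoning)
open import Relation.Nullary using (does)
open import Relation.Nullary.Decidable using (via-injection; yes; no; dec-true; dec-false)

module _ where
  open import Data.Nat using (_+_; _*_; _^_)
  open import Data.Nat.Properties using (*-comm; +-comm)
  open import Data.Nat.Tactic.RingSolver using (solve)
  open import Data.List using (_∷_; [])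

  4^k≡1+3m : ∀ k → ∃ λ m → 2 ^ (k * 2) ≡ 1 + 3 * m
  4^k≡1+3m zero    = 0 , refl
  4^k≡1+3m (suc k) with 4^k≡1+3m k
  ... | m , ih = 1 + 4 * m , trans (cong (λ n → 2 * (2 * n)) ih) (solve (m ∷ []))

  q²+q+1≡[1+3m*[m+1]]*3 : ∀ {q} m → q ≡ 1 + 3 * m → q * q + q + 1 ≡ (1 + 3 * m * (m + 1)) * 3
  q²+q+1≡[1+3m*[m+1]]*3 m refl = solve (m ∷ [])

  [q²+q+1]/3≡1+3m*[m+1] : ∀ {q} m → q ≡ 1 + 3 * m → (q * q + q + 1) / 3 ≡ 1 + 3 * m * (m + 1)
  [q²+q+1]/3≡1+3m*[m+1] m q≡1+3m =
    trans (cong (_/ 3) (q²+q+1≡[1+3m*[m+1]]*3 m q≡1+3m)) (m*n/n≡m (1 + 3 * m * (m + 1)) 3)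

  3*[[q²+q+1]/3]≡1+[q+1]*q : ∀ {q} m → q ≡ 1 + 3 * m → 3 * ((q * q + q + 1) / 3) ≡ 1 + (q + 1) * q
  3*[[q²+q+1]/3]≡1+[q+1]*q {q} m q≡1+3m = begin
    3 * ((q * q + q + 1) / 3)      ≡⟨ cong (3 *_) ([q²+q+1]/3≡1+3m*[m+1] m q≡1+3m) ⟩
    3 * (1 + 3 * m * (m + 1))      ≡⟨ *-comm 3 _ ⟩
    (1 + 3 * m * (m + 1)) * 3      ≡⟨ sym (q²+q+1≡[1+3m*[m+1]]*3 m q≡1+3m) ⟩
    q * q + q + 1                  ≡⟨ solve (q ∷ []) ⟩
    1 + (q + 1) * q                ∎
    where open ≡-Reasoning

  q+1≡2+3m : ∀ {q} m → q ≡ 1 + 3 * m → q + 1 ≡ 2 + 3 * m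
  q+1≡2+3m m refl = +-comm (1 + 3 * m) 1

  q*q≡1+[q+1]*3m : ∀ {q} m → q ≡ 1 + 3 * m → q * q ≡ 1 + (q + 1) * (3 * m)
  q*q≡1+[q+1]*3m m refl = solve (m ∷ [])

  [3m+[q+1]]*h≡q*q : ∀ {q} m h → q ≡ 1 + 3 * m → q ≡ h * 2 → (3 * m + (q + 1)) * h ≡ q * q
  [3m+[q+1]]*h≡q*q m h refl q≡h*2 = begin
    (3 * m + (1 + 3 * m + 1)) * h  ≡⟨ solve (m ∷ h ∷ []) ⟩
    (1 + 3 * m) * (h * 2)          ≡⟨ cong ((1 + 3 * m) *_) (sym q≡h*2) ⟩
    (1 + 3 * m) * (1 + 3 * m)      ∎
    where open ≡-Reasoning

CharacteristicTwo : FiniteField → Set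
CharacteristicTwo F = 1# + 1# ≡ 0#
  where open FiniteField F

module FiniteFieldProperties (F : FiniteField) where
  open FiniteField F

  commutativeRing : CommutativeRing 0ℓ 0ℓ
  commutativeRing = record { isCommutativeRing = isCommutativeRing }

  open CommutativeRing commutativeRing public
    using (*-comm; *-assoc; *-identityˡ; *-identityʳ; zeroˡ; zeroʳ; +-identityˡ; +-identityʳ)
  open CommutativeRing commutativeRing using (commutativeSemiring; *-commutativeMonoid; ring; -‿inverseʳ)
  import Algebra.Properties.CommutativeSemiring.Exp commutativeSemiring as Exp

  ^≡Exp^ : ∀ x n → x ^ n ≡ x Exp.^ n
  ^≡Exp^ x zero    = refl
  ^≡Exp^ x (suc n) = cong (x *_) (^≡Exp^ x n)

  ^-homo-* : ∀ x m n → x ^ (m ℕ.+ n) ≡ x ^ m * x ^ n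
  ^-homo-* x m n = trans (^≡Exp^ x (m ℕ.+ n))
    (trans (Exp.^-homo-* x m n) (sym (cong₂ _*_ (^≡Exp^ x m) (^≡Exp^ x n))))

  ^-assocʳ : ∀ x m n → (x ^ m) ^ n ≡ x ^ (m ℕ.* n)
  ^-assocʳ x m n = trans (^≡Exp^ (x ^ m) n)
    (trans (cong (Exp._^ n) (^≡Exp^ x m)) (trans (Exp.^-assocʳ x m n) (sym (^≡Exp^ x (m ℕ.* n)))))

  ^-distrib-* : ∀ x y n → (x * y) ^ n ≡ x ^ n * y ^ n
  ^-distrib-* x y n = trans (^≡Exp^ (x * y) n)
    (trans (Exp.^-distrib-* x y n) (sym (cong₂ _*_ (^≡Exp^ x n) (^≡Exp^ y n))))

  1^n≡1 : ∀ n → 1# ^ n ≡ 1#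
  1^n≡1 zero    = refl
  1^n≡1 (suc n) = trans (cong (1# *_) (1^n≡1 n)) (*-identityˡ 1#)

  0^n≡0 : ∀ n .{{_ : NonZero n}} → 0# ^ n ≡ 0#
  0^n≡0 (suc n) = zeroˡ (0# ^ n)

  x^n≡1⇒x^[r+n*k]≡x^r : ∀ {x} n r k → x ^ n ≡ 1# → x ^ (r ℕ.+ n ℕ.* k) ≡ x ^ r
  x^n≡1⇒x^[r+n*k]≡x^r {x} n r k x^n≡1 = begin
    x ^ (r ℕ.+ n ℕ.* k)   ≡⟨ ^-homo-* x r (n ℕ.* k) ⟩
    x ^ r * x ^ (n ℕ.* k) ≡⟨ cong (x ^ r *_) (sym (^-assocʳ x n k)) ⟩
    x ^ r * (x ^ n) ^ k   ≡⟨ cong (λ y → x ^ r * y ^ k) x^n≡1 ⟩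
    x ^ r * 1# ^ k        ≡⟨ cong (x ^ r *_) (1^n≡1 k) ⟩
    x ^ r * 1#            ≡⟨ *-identityʳ (x ^ r) ⟩
    x ^ r                 ∎
    where open ≡-Reasoning

  1≢0 : 1# ≢ 0#
  1≢0 1≡0 = 0≢1 (sym 1≡0)

  inverseˡ : ∀ x → x ≢ 0# → x ⁻¹ * x ≡ 1#
  inverseˡ x x≢0 = trans (*-comm (x ⁻¹) x) (inverseʳ x x≢0)

  x*y≡1⇒x≢0 : ∀ {x y} → x * y ≡ 1# → x ≢ 0#
  x*y≡1⇒x≢0 {x} {y} x*y≡1 refl = 1≢0 (trans (sym x*y≡1) (zeroˡ y))

  *-cancelˡ : ∀ {x y z} → x ≢ 0# → x * y ≡ x * z → y ≡ z
  *-cancelˡ {x} {y} {z} x≢0 x*y≡x*z = begin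
    y                ≡⟨ sym (*-identityˡ y) ⟩
    1# * y           ≡⟨ cong (_* y) (sym (inverseˡ x x≢0)) ⟩
    x ⁻¹ * x * y     ≡⟨ *-assoc (x ⁻¹) x y ⟩
    x ⁻¹ * (x * y)   ≡⟨ cong (x ⁻¹ *_) x*y≡x*z ⟩
    x ⁻¹ * (x * z)   ≡⟨ sym (*-assoc (x ⁻¹) x z) ⟩
    x ⁻¹ * x * z     ≡⟨ cong (_* z) (inverseˡ x x≢0) ⟩
    1# * z           ≡⟨ *-identityˡ z ⟩
    z                ∎
    where open ≡-Reasoning

  x*y≡1⇒y≡x⁻¹ : ∀ {x y} → x * y ≡ 1# → y ≡ x ⁻¹
  x*y≡1⇒y≡x⁻¹ {x} {y} x*y≡1 =
    *-cancelˡ (x*y≡1⇒x≢0 x*y≡1) (trans x*y≡1 (sym (inverseʳ x (x*y≡1⇒x≢0 x*y≡1))))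

  x≢0∧y≢0⇒x*y≢0 : ∀ {x y} → x ≢ 0# → y ≢ 0# → x * y ≢ 0#
  x≢0∧y≢0⇒x*y≢0 {x} {y} x≢0 y≢0 x*y≡0 = y≢0 (*-cancelˡ x≢0 (trans x*y≡0 (sym (zeroʳ x))))

  x≢0⇒x^n≢0 : ∀ {x} n → x ≢ 0# → x ^ n ≢ 0#
  x≢0⇒x^n≢0 zero    x≢0 = 1≢0
  x≢0⇒x^n≢0 (suc n) x≢0 = x≢0∧y≢0⇒x*y≢0 x≢0 (x≢0⇒x^n≢0 n x≢0)

  x≢0⇒x⁻¹≢0 : ∀ {x} → x ≢ 0# → x ⁻¹ ≢ 0#
  x≢0⇒x⁻¹≢0 {x} x≢0 = x*y≡1⇒x≢0 (inverseˡ x x≢0)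

  ⁻¹-involutive : ∀ {x} → x ≢ 0# → (x ⁻¹) ⁻¹ ≡ x
  ⁻¹-involutive {x} x≢0 = sym (x*y≡1⇒y≡x⁻¹ (inverseˡ x x≢0))

  ^-⁻¹-comm : ∀ {x} n → x ≢ 0# → (x ⁻¹) ^ n ≡ (x ^ n) ⁻¹
  ^-⁻¹-comm {x} n x≢0 = x*y≡1⇒y≡x⁻¹ (begin
    x ^ n * (x ⁻¹) ^ n   ≡⟨ sym (^-distrib-* x (x ⁻¹) n) ⟩
    (x * x ⁻¹) ^ n       ≡⟨ cong (_^ n) (inverseʳ x x≢0) ⟩
    1# ^ n               ≡⟨ 1^n≡1 n ⟩
    1#                   ∎)
    where open ≡-Reasoning

  x^[n+1]≡1⇒x*x^n≡1 : ∀ {x} n → x ^ (n ℕ.+ 1) ≡ 1# → x * x ^ n ≡ 1#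
  x^[n+1]≡1⇒x*x^n≡1 {x} n x^[n+1]≡1 = begin
    x * x ^ n         ≡⟨ *-comm x (x ^ n) ⟩
    x ^ n * x         ≡⟨ cong (x ^ n *_) (sym (*-identityʳ x)) ⟩
    x ^ n * x ^ 1     ≡⟨ sym (^-homo-* x n 1) ⟩
    x ^ (n ℕ.+ 1)     ≡⟨ x^[n+1]≡1 ⟩
    1#                ∎
    where open ≡-Reasoning

  x^[n+1]≡1⇒x≢0 : ∀ {x} n → x ^ (n ℕ.+ 1) ≡ 1# → x ≢ 0#
  x^[n+1]≡1⇒x≢0 n = x*y≡1⇒x≢0 ∘ x^[n+1]≡1⇒x*x^n≡1 n

  x^[n+1]≡1⇒x^n≡x⁻¹ : ∀ {x} n → x ^ (n ℕ.+ 1) ≡ 1# → x ^ n ≡ x ⁻¹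
  x^[n+1]≡1⇒x^n≡x⁻¹ n = x*y≡1⇒y≡x⁻¹ ∘ x^[n+1]≡1⇒x*x^n≡1 n

  x^n≡1⇒[x^k]^n≡1 : ∀ {x} k n → x ^ n ≡ 1# → (x ^ k) ^ n ≡ 1#
  x^n≡1⇒[x^k]^n≡1 {x} k n x^n≡1 = begin
    (x ^ k) ^ n    ≡⟨ ^-assocʳ x k n ⟩
    x ^ (k ℕ.* n)  ≡⟨ cong (x ^_) (ℕ.*-comm k n) ⟩
    x ^ (n ℕ.* k)  ≡⟨ sym (^-assocʳ x n k) ⟩
    (x ^ n) ^ k    ≡⟨ cong (_^ k) x^n≡1 ⟩
    1# ^ k         ≡⟨ 1^n≡1 k ⟩
    1#             ∎
    where open ≡-Reasoning

  x^[1+n]≡x⇒x^n≡1 : ∀ {x} n → x ≢ 0# → x ^ (1 ℕ.+ n) ≡ x → x ^ n ≡ 1#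
  x^[1+n]≡x⇒x^n≡1 {x} n x≢0 x^[1+n]≡x = *-cancelˡ x≢0 (trans x^[1+n]≡x (sym (*-identityʳ x)))

  x÷y*y≡x : ∀ {x y} → y ≢ 0# → x ÷ y * y ≡ x
  x÷y*y≡x {x} {y} y≢0 = trans (*-assoc x (y ⁻¹) y) (trans (cong (x *_) (inverseˡ y y≢0)) (*-identityʳ x))

  ^-distrib-÷ : ∀ {x y} n → y ≢ 0# → (x ÷ y) ^ n ≡ x ^ n ÷ y ^ n
  ^-distrib-÷ {x} {y} n y≢0 = trans (^-distrib-* x (y ⁻¹) n) (cong (x ^ n *_) (^-⁻¹-comm n y≢0))

  x*[y^n÷z^n]*w^n≡x*[[y÷z]*w]^n : ∀ {x y z w} n → z ≢ 0# → x * (y ^ n ÷ z ^ n) * w ^ n ≡ x * ((y ÷ z) * w) ^ n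
  x*[y^n÷z^n]*w^n≡x*[[y÷z]*w]^n {x} {y} {z} {w} n z≢0 = begin
    x * (y ^ n ÷ z ^ n) * w ^ n  ≡⟨ cong (λ c → x * c * w ^ n) (sym (^-distrib-÷ n z≢0)) ⟩
    x * (y ÷ z) ^ n * w ^ n      ≡⟨ *-assoc x ((y ÷ z) ^ n) (w ^ n) ⟩
    x * ((y ÷ z) ^ n * w ^ n)    ≡⟨ cong (x *_) (sym (^-distrib-* (y ÷ z) w n)) ⟩
    x * ((y ÷ z) * w) ^ n        ∎
    where open ≡-Reasoning

  -- Opaque, so that `does (y ≟ 0#)` stays abstractable by `with` instead of unfolding to a test on
  -- the enumeration.
  infix 4 _≟_
  opaque
    _≟_ : DecidableEquality Carrier
    _≟_ = via-injection (↔⇒↣ enumeration) Fin._≟_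

  open Algebra.Properties.CommutativeMonoid.Sum *-commutativeMonoid
    using (∑-distrib-+; sum-permute; sum-cong-≗; sum-remove; sum-replicate; sum-replicate-zero)
    renaming (sum to ∏)
  open Inverse enumeration using (to; from; strictlyInverseˡ; strictlyInverseʳ)

  ∏-≢0 : ∀ {n} (f : Fin n → Carrier) → (∀ i → f i ≢ 0#) → ∏ f ≢ 0#
  ∏-≢0 {zero}  f f≢0 = 1≢0
  ∏-≢0 {suc n} f f≢0 = x≢0∧y≢0⇒x*y≢0 (f≢0 zero) (∏-≢0 (f ∘ suc) (f≢0 ∘ suc))

  ∏-single : ∀ {n} (f : Fin n → Carrier) i → (∀ j → j ≢ i → f j ≡ 1#) → ∏ f ≡ f i
  ∏-single {suc n} f i f≡1 = begin
    ∏ f                     ≡⟨ sum-remove f ⟩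
    f i * ∏ (removeAt f i)  ≡⟨ cong (f i *_) (sum-cong-≗ (λ j → f≡1 _ (punchInᵢ≢i i j))) ⟩
    f i * ∏ (replicate n 1#) ≡⟨ cong (f i *_) (sum-replicate-zero n) ⟩
    f i * 1#                ≡⟨ *-identityʳ (f i) ⟩
    f i                     ∎
    where open ≡-Reasoning

  ∏-const : ∀ n x → ∏ (replicate n x) ≡ x ^ n
  ∏-const n x = trans (sum-replicate n) (sym (^≡Exp^ x n))

  scaling : ∀ {x} → x ≢ 0# → Carrier ↔ Carrier
  scaling {x} x≢0 = mk↔ₛ′ (x *_) (x ⁻¹ *_) (cancel x (x ⁻¹) (inverseʳ x x≢0)) (cancel (x ⁻¹) x (inverseˡ x x≢0))
    where
    cancel : ∀ a b → a * b ≡ 1# → ∀ y → a * (b * y) ≡ y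
    cancel a b a*b≡1 y = trans (sym (*-assoc a b y)) (trans (cong (_* y) a*b≡1) (*-identityˡ y))

  -- For x ≢ 0, y ↦ x y permutes the field.  Replace 0 by 1 to make all factors invertible; then
  -- ∏ x·unzero(y) = ∏ unzero(x y) · x, the extra x coming from y = 0, so x ^ size = x.
  module Fermat {x : Carrier} (x≢0 : x ≢ 0#) where

    unzero : Carrier → Carrier
    unzero y = if does (y ≟ 0#) then 1# else y

    x-at-0 : Carrier → Carrier
    x-at-0 y = if does (y ≟ 0#) then x else 1#

    unzero-0 : unzero 0# ≡ 1#
    unzero-0 = cong (if_then 1# else 0#) (dec-true (0# ≟ 0#) refl)

    x-at-0-0 : x-at-0 0# ≡ x
    x-at-0-0 = cong (if_then x else 1#) (dec-true (0# ≟ 0#) refl)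

    unzero-≢0 : ∀ {y} → y ≢ 0# → unzero y ≡ y
    unzero-≢0 {y} y≢0 = cong (if_then 1# else y) (dec-false (y ≟ 0#) y≢0)

    x-at-0-≢0 : ∀ {y} → y ≢ 0# → x-at-0 y ≡ 1#
    x-at-0-≢0 {y} y≢0 = cong (if_then x else 1#) (dec-false (y ≟ 0#) y≢0)

    unzero≢0 : ∀ y → unzero y ≢ 0#
    unzero≢0 y with y ≟ 0#
    ... | yes _   = 1≢0
    ... | no  y≢0 = y≢0

    x*unzero≡unzero[x*]*x-at-0 : ∀ y → x * unzero y ≡ unzero (x * y) * x-at-0 y
    x*unzero≡unzero[x*]*x-at-0 y = case y ≟ 0# of λ where
        (yes refl) → begin
          x * unzero 0#                ≡⟨ cong (x *_) unzero-0 ⟩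
          x * 1#                       ≡⟨ *-comm x 1# ⟩
          1# * x                       ≡⟨ sym (cong₂ _*_ (trans (cong unzero (zeroʳ x)) unzero-0) x-at-0-0) ⟩
          unzero (x * 0#) * x-at-0 0#  ∎
        (no y≢0) → begin
          x * unzero y                 ≡⟨ cong (x *_) (unzero-≢0 y≢0) ⟩
          x * y                        ≡⟨ sym (*-identityʳ (x * y)) ⟩
          x * y * 1#                   ≡⟨ sym (cong₂ _*_ (unzero-≢0 (x≢0∧y≢0⇒x*y≢0 x≢0 y≢0)) (x-at-0-≢0 y≢0)) ⟩
          unzero (x * y) * x-at-0 y    ∎
      where open ≡-Reasoning

    ∏x-at-0≡x : ∏ (x-at-0 ∘ from) ≡ x
    ∏x-at-0≡x = begin
      ∏ (x-at-0 ∘ from)    ≡⟨ ∏-single (x-at-0 ∘ from) (to 0#) (λ i i≢ → x-at-0-≢0 (i≢ ∘ from≡0⇒≡to0)) ⟩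
      x-at-0 (from (to 0#)) ≡⟨ cong x-at-0 (strictlyInverseʳ 0#) ⟩
      x-at-0 0#            ≡⟨ x-at-0-0 ⟩
      x                    ∎
      where
      open ≡-Reasoning
      from≡0⇒≡to0 : ∀ {i} → from i ≡ 0# → i ≡ to 0#
      from≡0⇒≡to0 {i} from-i≡0 = trans (sym (strictlyInverseˡ i)) (cong to from-i≡0)

    π : Permutation size size
    π = enumeration ↔-∘ (scaling x≢0 ↔-∘ ↔-sym enumeration)

    P : Carrier
    P = ∏ (unzero ∘ from)

    P≡∏unzero[x*] : P ≡ ∏ (λ i → unzero (x * from i))
    P≡∏unzero[x*] = trans (sum-permute (unzero ∘ from) π)
      (sum-cong-≗ (λ i → cong unzero (strictlyInverseʳ (x * from i))))

    P*x^size≡P*x : P * x ^ size ≡ P * x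
    P*x^size≡P*x = begin
      P * x ^ size                                        ≡⟨ *-comm P (x ^ size) ⟩
      x ^ size * P                                        ≡⟨ cong (_* P) (sym (∏-const size x)) ⟩
      ∏ (replicate size x) * P                            ≡⟨ sym (∑-distrib-+ (replicate size x) (unzero ∘ from)) ⟩
      ∏ (λ i → x * unzero (from i))                       ≡⟨ sum-cong-≗ (x*unzero≡unzero[x*]*x-at-0 ∘ from) ⟩
      ∏ (λ i → unzero (x * from i) * x-at-0 (from i))     ≡⟨ ∑-distrib-+ (λ i → unzero (x * from i)) (x-at-0 ∘ from) ⟩
      ∏ (λ i → unzero (x * from i)) * ∏ (x-at-0 ∘ from)   ≡⟨ cong₂ _*_ (sym P≡∏unzero[x*]) ∏x-at-0≡x ⟩
      P * x                                               ∎
      where open ≡-Reasoning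

  x^size≡x : ∀ x → x ^ size ≡ x
  x^size≡x x with x ≟ 0#
  ... | yes refl = 0^n≡0 size {{nonZeroIndex (Inverse.to enumeration 0#)}}
  ... | no  x≢0  = *-cancelˡ (∏-≢0 (unzero ∘ from) (unzero≢0 ∘ from)) P*x^size≡P*x
    where open Fermat x≢0

  2∣size⇒1+1≡0 : 2 ∣ size → CharacteristicTwo F
  2∣size⇒1+1≡0 (divides k size≡k*2) = begin
    1# + 1#    ≡⟨ cong (1# +_) (sym -1≡1) ⟩
    1# + - 1#  ≡⟨ -‿inverseʳ 1# ⟩
    0#         ∎
    where
    open ≡-Reasoning
    open import Algebra.Properties.Ring ring using (-1*x≈-x; -‿involutive)
    -1≡1 : - 1# ≡ 1#
    -1≡1 = begin
      - 1#                 ≡⟨ sym (x^size≡x (- 1#)) ⟩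
      (- 1#) ^ size        ≡⟨ cong ((- 1#) ^_) (trans size≡k*2 (ℕ.*-comm k 2)) ⟩
      (- 1#) ^ (2 ℕ.* k)   ≡⟨ sym (^-assocʳ (- 1#) 2 k) ⟩
      ((- 1#) ^ 2) ^ k     ≡⟨ cong (λ y → (- 1# * y) ^ k) (*-identityʳ (- 1#)) ⟩
      (- 1# * - 1#) ^ k    ≡⟨ cong (_^ k) (trans (-1*x≈-x (- 1#)) (-‿involutive 1#)) ⟩
      1# ^ k               ≡⟨ 1^n≡1 k ⟩
      1#                   ∎

module Characteristic2 (F : FiniteField) (1+1≡0 : CharacteristicTwo F) where
  open FiniteField F
  open FiniteFieldProperties F
  open CommutativeRing commutativeRing using (-‿inverseˡ; +-assoc)

  -1≡1 : - 1# ≡ 1#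
  -1≡1 = begin
    - 1#              ≡⟨ sym (+-identityʳ (- 1#)) ⟩
    - 1# + 0#         ≡⟨ cong (- 1# +_) (sym 1+1≡0) ⟩
    - 1# + (1# + 1#)  ≡⟨ sym (+-assoc (- 1#) 1# 1#) ⟩
    - 1# + 1# + 1#    ≡⟨ cong (_+ 1#) (-‿inverseˡ 1#) ⟩
    0# + 1#           ≡⟨ +-identityˡ 1# ⟩
    1#                ∎
    where open ≡-Reasoning

  -0≡0 : - 0# ≡ 0#
  -0≡0 = trans (sym (+-identityʳ (- 0#))) (-‿inverseˡ 0#)

  -- Coefficients in 𝔽₂ (Bool with xor and ∧) let the ring solver decide identities that hold only in
  -- characteristic 2, such as (x + y)² = x² + y².
  ⟦_⟧ : Bool → Carrier
  ⟦ false ⟧ = 0#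
  ⟦ true  ⟧ = 1#

  𝔽₂→F : CommutativeRing.rawRing xor-∧-commutativeRing -Raw-AlmostCommutative⟶ fromCommutativeRing commutativeRing
  𝔽₂→F = record
    { ⟦_⟧    = ⟦_⟧
    ; +-homo = λ where
        false false → sym (+-identityˡ 0#)
        false true  → sym (+-identityˡ 1#)
        true  false → sym (+-identityʳ 1#)
        true  true  → sym 1+1≡0
    ; *-homo = λ where
        false false → sym (zeroˡ 0#)
        false true  → sym (zeroˡ 1#)
        true  false → sym (zeroʳ 1#)
        true  true  → sym (*-identityˡ 1#)
    ; -‿homo = λ where
        false → sym -0≡0
        true  → sym -1≡1
    ; 0-homo = refl
    ; 1-homo = refl
    }

  ⟦⟧-≟ : WeaklyDecidable (λ a b → ⟦ a ⟧ ≡ ⟦ b ⟧)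
  ⟦⟧-≟ a b = Maybe.map (cong ⟦_⟧) (dec⇒weaklyDec Bool._≟_ a b)

  open import Algebra.Solver.Ring (CommutativeRing.rawRing xor-∧-commutativeRing) (fromCommutativeRing commutativeRing) 𝔽₂→F ⟦⟧-≟ public
    using (solve; _:=_; _:+_; _:*_; _:^_; con)

  [x+y]^2≡x^2+y^2 : ∀ x y → (x + y) ^ 2 ≡ x ^ 2 + y ^ 2
  [x+y]^2≡x^2+y^2 = solve 2 (λ x y → (x :+ y) :^ 2 := x :^ 2 :+ y :^ 2) refl

  frobenius : ∀ k x y → (x + y) ^ (2 ℕ.^ k) ≡ x ^ (2 ℕ.^ k) + y ^ (2 ℕ.^ k)
  frobenius zero    x y = trans (*-identityʳ (x + y)) (sym (cong₂ _+_ (*-identityʳ x) (*-identityʳ y)))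
  frobenius (suc k) x y = begin
    (x + y) ^ (2 ℕ.* K)          ≡⟨ sym (^-assocʳ (x + y) 2 K) ⟩
    ((x + y) ^ 2) ^ K            ≡⟨ cong (_^ K) ([x+y]^2≡x^2+y^2 x y) ⟩
    (x ^ 2 + y ^ 2) ^ K          ≡⟨ frobenius k (x ^ 2) (y ^ 2) ⟩
    (x ^ 2) ^ K + (y ^ 2) ^ K    ≡⟨ cong₂ _+_ (^-assocʳ x 2 K) (^-assocʳ y 2 K) ⟩
    x ^ (2 ℕ.* K) + y ^ (2 ℕ.* K) ∎
    where
    open ≡-Reasoning
    K : ℕ
    K = 2 ℕ.^ k

module InverseOfσ (e : ℕ) (F : FiniteField) (1+1≡0 : CharacteristicTwo F)
                  (m : ℕ) (q≡1+3m : Setting.q e F ≡ 1 ℕ.+ 3 ℕ.* m) where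
  open Setting e F
  open FiniteFieldProperties F
  open Characteristic2 F 1+1≡0
  open ≡-Reasoning

  z∈μ⇒z^q≡z⁻¹ : ∀ {z} → InMu z → z ^ q ≡ z ⁻¹
  z∈μ⇒z^q≡z⁻¹ = x^[n+1]≡1⇒x^n≡x⁻¹ q

  z∈μ⇒[z⁻¹]^q≡z : ∀ {z} → InMu z → (z ⁻¹) ^ q ≡ z
  z∈μ⇒[z⁻¹]^q≡z {z} z∈μ = begin
    (z ⁻¹) ^ q   ≡⟨ ^-⁻¹-comm q z≢0 ⟩
    (z ^ q) ⁻¹   ≡⟨ cong _⁻¹ (z∈μ⇒z^q≡z⁻¹ z∈μ) ⟩
    (z ⁻¹) ⁻¹    ≡⟨ ⁻¹-involutive z≢0 ⟩
    z            ∎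
    where
    z≢0 : z ≢ 0#
    z≢0 = x^[n+1]≡1⇒x≢0 q z∈μ

  t∈Fq*∧s∈Fq*⇒t÷s∈Fq* : ∀ {t s} → InFqStar t → InFqStar s → InFqStar (t ÷ s)
  t∈Fq*∧s∈Fq*⇒t÷s∈Fq* {t} {s} (t^q≡t , t≢0) (s^q≡s , s≢0) =
    (begin
      (t * s ⁻¹) ^ q      ≡⟨ ^-distrib-* t (s ⁻¹) q ⟩
      t ^ q * (s ⁻¹) ^ q  ≡⟨ cong₂ _*_ t^q≡t (^-⁻¹-comm q s≢0) ⟩
      t * (s ^ q) ⁻¹      ≡⟨ cong (λ y → t * y ⁻¹) s^q≡s ⟩
      t * s ⁻¹            ∎) ,
    x≢0∧y≢0⇒x*y≢0 t≢0 (x≢0⇒x⁻¹≢0 s≢0)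

  den : Carrier → Carrier
  den w = 1# + w + w ⁻¹

  w∈μ⇒den[w]^q≡den[w] : ∀ {w} → InMu w → den w ^ q ≡ den w
  w∈μ⇒den[w]^q≡den[w] {w} w∈μ = begin
    (1# + w + w ⁻¹) ^ q              ≡⟨ frobenius e (1# + w) (w ⁻¹) ⟩
    (1# + w) ^ q + (w ⁻¹) ^ q        ≡⟨ cong (_+ (w ⁻¹) ^ q) (frobenius e 1# w) ⟩
    1# ^ q + w ^ q + (w ⁻¹) ^ q      ≡⟨ cong₂ (λ a b → a + b + (w ⁻¹) ^ q) (1^n≡1 q) (z∈μ⇒z^q≡z⁻¹ w∈μ) ⟩
    1# + w ⁻¹ + (w ⁻¹) ^ q           ≡⟨ cong (1# + w ⁻¹ +_) (z∈μ⇒[z⁻¹]^q≡z w∈μ) ⟩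
    1# + w ⁻¹ + w                    ≡⟨ solve 2 (λ a b → con true :+ a :+ b := con true :+ b :+ a) refl (w ⁻¹) w ⟩
    1# + w + w ⁻¹                    ∎

  w∈μ⇒den[w]≢0 : ∀ {w} → InMu w → den w ≢ 0#
  w∈μ⇒den[w]≢0 {w} w∈μ den[w]≡0 = 1≢0 (trans (sym den[1]≡1) (trans (cong den (sym w≡1)) den[w]≡0))
    where
    w≢0 : w ≢ 0#
    w≢0 = x^[n+1]≡1⇒x≢0 q w∈μ
    w*w+w+1≡0 : w * w + w + 1# ≡ 0#
    w*w+w+1≡0 = begin
      w * w + w + 1#           ≡⟨ cong (w * w + w +_) (sym (inverseʳ w w≢0)) ⟩
      w * w + w + w * w ⁻¹     ≡⟨ solve 2 (λ w w' → w :* w :+ w :+ w :* w' := w :* (con true :+ w :+ w')) refl w (w ⁻¹) ⟩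
      w * den w                ≡⟨ cong (w *_) den[w]≡0 ⟩
      w * 0#                   ≡⟨ zeroʳ w ⟩
      0#                       ∎
    w^3≡1 : w ^ 3 ≡ 1#
    w^3≡1 = begin
      w ^ 3                               ≡⟨ solve 1 (λ w → w :^ 3 := (w :+ con true) :* (w :* w :+ w :+ con true) :+ con true) refl w ⟩
      (w + 1#) * (w * w + w + 1#) + 1#    ≡⟨ cong (λ y → (w + 1#) * y + 1#) w*w+w+1≡0 ⟩
      (w + 1#) * 0# + 1#                  ≡⟨ cong (_+ 1#) (zeroʳ (w + 1#)) ⟩
      0# + 1#                             ≡⟨ +-identityˡ 1# ⟩
      1#                                  ∎
    w^2≡1 : w ^ 2 ≡ 1#
    w^2≡1 = begin
      w ^ 2                   ≡⟨ sym (x^n≡1⇒x^[r+n*k]≡x^r 3 2 m w^3≡1) ⟩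
      w ^ (2 ℕ.+ 3 ℕ.* m)     ≡⟨ cong (w ^_) (sym (q+1≡2+3m m q≡1+3m)) ⟩
      w ^ (q ℕ.+ 1)           ≡⟨ w∈μ ⟩
      1#                      ∎
    w≡1 : w ≡ 1#
    w≡1 = trans (sym (*-identityʳ w)) (trans (cong (w *_) (sym w^2≡1)) w^3≡1)
    den[1]≡1 : den 1# ≡ 1#
    den[1]≡1 = begin
      1# + 1# + 1# ⁻¹   ≡⟨ cong (1# + 1# +_) (sym (x*y≡1⇒y≡x⁻¹ (*-identityˡ 1#))) ⟩
      1# + 1# + 1#      ≡⟨ cong (_+ 1#) 1+1≡0 ⟩
      0# + 1#           ≡⟨ +-identityˡ 1# ⟩
      1#                ∎

  t∈Fq*⇒t^d≡t : ∀ {t} → InFqStar t → t ^ d ≡ t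
  t∈Fq*⇒t^d≡t {t} (t^q≡t , t≢0) = begin
    t ^ d                                ≡⟨ cong (t ^_) ([q²+q+1]/3≡1+3m*[m+1] m q≡1+3m) ⟩
    t ^ (1 ℕ.+ 3 ℕ.* m ℕ.* (m ℕ.+ 1))    ≡⟨ x^n≡1⇒x^[r+n*k]≡x^r (3 ℕ.* m) 1 (m ℕ.+ 1) t^3m≡1 ⟩
    t ^ 1                                ≡⟨ *-identityʳ t ⟩
    t                                    ∎
    where
    t^3m≡1 : t ^ (3 ℕ.* m) ≡ 1#
    t^3m≡1 = x^[1+n]≡x⇒x^n≡1 (3 ℕ.* m) t≢0 (subst (λ n → t ^ n ≡ t) q≡1+3m t^q≡t)

  z∈μ⇒[z^3]^d≡z : ∀ {z} → InMu z → (z ^ 3) ^ d ≡ z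
  z∈μ⇒[z^3]^d≡z {z} z∈μ = begin
    (z ^ 3) ^ d                  ≡⟨ ^-assocʳ z 3 d ⟩
    z ^ (3 ℕ.* d)                ≡⟨ cong (z ^_) (3*[[q²+q+1]/3]≡1+[q+1]*q m q≡1+3m) ⟩
    z ^ (1 ℕ.+ (q ℕ.+ 1) ℕ.* q)  ≡⟨ x^n≡1⇒x^[r+n*k]≡x^r (q ℕ.+ 1) 1 q z∈μ ⟩
    z ^ 1                        ≡⟨ *-identityʳ z ⟩
    z                            ∎

  σ[z^3*t]≡z*t*den[z^2] : ∀ {z t} → InMu z → InFqStar t → σ (z ^ 3 * t) ≡ z * t * den (z ^ 2)
  σ[z^3*t]≡z*t*den[z^2] {z} {t} z∈μ t∈Fq* = begin
    z ^ 3 * t + (z ^ 3 * t) ^ d + (z ^ 3 * t) ^ (d ℕ.* q)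
      ≡⟨ cong₂ (λ a b → z ^ 3 * t + a + b) [z^3*t]^d≡z*t [z^3*t]^[d*q]≡z⁻¹*t ⟩
    z ^ 3 * t + z * t + z ⁻¹ * t
      ≡⟨ cong (z ^ 3 * t + z * t +_) (sym z*z⁻¹*[z⁻¹*t]≡z⁻¹*t) ⟩
    z ^ 3 * t + z * t + z * z ⁻¹ * (z ⁻¹ * t)
      ≡⟨ solve 3 (λ z z′ t → z :^ 3 :* t :+ z :* t :+ z :* z′ :* (z′ :* t)
                             := z :* t :* (con true :+ z :^ 2 :+ z′ :^ 2)) refl z (z ⁻¹) t ⟩
    z * t * (1# + z ^ 2 + (z ⁻¹) ^ 2)
      ≡⟨ cong (λ y → z * t * (1# + z ^ 2 + y)) (^-⁻¹-comm 2 z≢0) ⟩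
    z * t * den (z ^ 2)
      ∎
    where
    z≢0 : z ≢ 0#
    z≢0 = x^[n+1]≡1⇒x≢0 q z∈μ
    z*z⁻¹*[z⁻¹*t]≡z⁻¹*t : z * z ⁻¹ * (z ⁻¹ * t) ≡ z ⁻¹ * t
    z*z⁻¹*[z⁻¹*t]≡z⁻¹*t = trans (cong (_* (z ⁻¹ * t)) (inverseʳ z z≢0)) (*-identityˡ (z ⁻¹ * t))
    [z^3*t]^d≡z*t : (z ^ 3 * t) ^ d ≡ z * t
    [z^3*t]^d≡z*t = trans (^-distrib-* (z ^ 3) t d) (cong₂ _*_ (z∈μ⇒[z^3]^d≡z z∈μ) (t∈Fq*⇒t^d≡t t∈Fq*))
    [z^3*t]^[d*q]≡z⁻¹*t : (z ^ 3 * t) ^ (d ℕ.* q) ≡ z ⁻¹ * t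
    [z^3*t]^[d*q]≡z⁻¹*t = begin
      (z ^ 3 * t) ^ (d ℕ.* q)  ≡⟨ sym (^-assocʳ (z ^ 3 * t) d q) ⟩
      ((z ^ 3 * t) ^ d) ^ q    ≡⟨ cong (_^ q) [z^3*t]^d≡z*t ⟩
      (z * t) ^ q              ≡⟨ ^-distrib-* z t q ⟩
      z ^ q * t ^ q            ≡⟨ cong₂ _*_ (z∈μ⇒z^q≡z⁻¹ z∈μ) (proj₁ t∈Fq*) ⟩
      z ⁻¹ * t                 ∎

  τ[z*t]≡[z^2÷den[z^2]]*[z*t] : ∀ τ → (∀ y → τ (σ y) ≡ y) →
    ∀ z → InMu z → ∀ t → InFqStar t → τ (z * t) ≡ (z ^ 2 ÷ den (z ^ 2)) * (z * t)
  τ[z*t]≡[z^2÷den[z^2]]*[z*t] τ τ∘σ≗id z z∈μ t t∈Fq* = begin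
    τ (z * t)              ≡⟨ cong τ (sym σ[z^3*t′]≡z*t) ⟩
    τ (σ (z ^ 3 * t′))     ≡⟨ τ∘σ≗id (z ^ 3 * t′) ⟩
    z ^ 3 * (t * s ⁻¹)     ≡⟨ solve 3 (λ z t s′ → z :^ 3 :* (t :* s′) := z :^ 2 :* s′ :* (z :* t)) refl z t (s ⁻¹) ⟩
    (z ^ 2 ÷ s) * (z * t)  ∎
    where
    s : Carrier
    s = den (z ^ 2)
    z^2∈μ : InMu (z ^ 2)
    z^2∈μ = x^n≡1⇒[x^k]^n≡1 2 (q ℕ.+ 1) z∈μ
    s≢0 : s ≢ 0#
    s≢0 = w∈μ⇒den[w]≢0 z^2∈μ
    t′ : Carrier
    t′ = t ÷ s
    t′∈Fq* : InFqStar t′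
    t′∈Fq* = t∈Fq*∧s∈Fq*⇒t÷s∈Fq* t∈Fq* (w∈μ⇒den[w]^q≡den[w] z^2∈μ , s≢0)
    σ[z^3*t′]≡z*t : σ (z ^ 3 * t′) ≡ z * t
    σ[z^3*t′]≡z*t = begin
      σ (z ^ 3 * t′)  ≡⟨ σ[z^3*t]≡z*t*den[z^2] z∈μ t′∈Fq* ⟩
      z * t′ * s      ≡⟨ *-assoc z t′ s ⟩
      z * (t′ * s)    ≡⟨ cong (z *_) (x÷y*y≡x s≢0) ⟩
      z * t           ∎

  σ[0]≡0 : σ 0# ≡ 0#
  σ[0]≡0 = begin
    0# + 0# ^ d + 0# ^ (d ℕ.* q)  ≡⟨ cong₂ (λ a b → 0# + a + b) 0^d≡0 0^[d*q]≡0 ⟩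
    0# + 0# + 0#                  ≡⟨ trans (+-identityʳ (0# + 0#)) (+-identityʳ 0#) ⟩
    0#                            ∎
    where
    0^d≡0 : 0# ^ d ≡ 0#
    0^d≡0 = trans (cong (0# ^_) ([q²+q+1]/3≡1+3m*[m+1] m q≡1+3m)) (0^n≡0 (1 ℕ.+ 3 ℕ.* m ℕ.* (m ℕ.+ 1)))
    0^[d*q]≡0 : 0# ^ (d ℕ.* q) ≡ 0#
    0^[d*q]≡0 = trans (sym (^-assocʳ 0# d q)) (trans (cong (_^ q) 0^d≡0) (0^n≡0 q {{ℕ.m^n≢0 2 e}}))

module Cosets (e : ℕ) (F : FiniteField) (size≡q*q : FiniteField.size F ≡ Setting.q e F ℕ.* Setting.q e F)
              (m : ℕ) (q≡1+3m : Setting.q e F ≡ 1 ℕ.+ 3 ℕ.* m) (2∣q : 2 ∣ Setting.q e F) where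
  open Setting e F
  open FiniteFieldProperties F
  open ≡-Reasoning

  1+1≡0 : CharacteristicTwo F
  1+1≡0 = 2∣size⇒1+1≡0 (subst (2 ∣_) (sym size≡q*q) (∣m⇒∣m*n q 2∣q))

  open InverseOfσ e F 1+1≡0 m q≡1+3m public

  x^[[q+1]*3m]≡1 : ∀ {x} → x ≢ 0# → x ^ ((q ℕ.+ 1) ℕ.* (3 ℕ.* m)) ≡ 1#
  x^[[q+1]*3m]≡1 {x} x≢0 = x^[1+n]≡x⇒x^n≡1 ((q ℕ.+ 1) ℕ.* (3 ℕ.* m)) x≢0 (begin
    x ^ (1 ℕ.+ (q ℕ.+ 1) ℕ.* (3 ℕ.* m))  ≡⟨ cong (x ^_) (sym (q*q≡1+[q+1]*3m m q≡1+3m)) ⟩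
    x ^ (q ℕ.* q)                        ≡⟨ cong (x ^_) (sym size≡q*q) ⟩
    x ^ size                             ≡⟨ x^size≡x x ⟩
    x                                    ∎)

  x≢0⇒x∈μ*Fq* : ∀ {x} → x ≢ 0# → ∃₂ λ z t → InMu z × InFqStar t × x ≡ z * t
  x≢0⇒x∈μ*Fq* {x} x≢0 = z , t , z∈μ , (t^q≡t , t≢0) , x≡z*t
    where
    -- With 2 h = q: z ^ (q + 1) and t ^ (q - 1) are powers of x ^ (q² - 1) = 1, and
    -- (q - 1) h + (q + 1) h = q², so z t = x ^ (q²) = x.
    h : ℕ
    h = _∣_.quotient 2∣q
    x^[q-1] : Carrier
    x^[q-1] = x ^ (3 ℕ.* m)
    x^[q+1] : Carrier
    x^[q+1] = x ^ (q ℕ.+ 1)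
    z t : Carrier
    z = x^[q-1] ^ h
    t = x^[q+1] ^ h
    z∈μ : InMu z
    z∈μ = x^n≡1⇒[x^k]^n≡1 h (q ℕ.+ 1) (begin
      x^[q-1] ^ (q ℕ.+ 1)            ≡⟨ ^-assocʳ x (3 ℕ.* m) (q ℕ.+ 1) ⟩
      x ^ (3 ℕ.* m ℕ.* (q ℕ.+ 1))    ≡⟨ cong (x ^_) (ℕ.*-comm (3 ℕ.* m) (q ℕ.+ 1)) ⟩
      x ^ ((q ℕ.+ 1) ℕ.* (3 ℕ.* m))  ≡⟨ x^[[q+1]*3m]≡1 x≢0 ⟩
      1#                             ∎)
    t^3m≡1 : t ^ (3 ℕ.* m) ≡ 1#
    t^3m≡1 = x^n≡1⇒[x^k]^n≡1 h (3 ℕ.* m) (trans (^-assocʳ x (q ℕ.+ 1) (3 ℕ.* m)) (x^[[q+1]*3m]≡1 x≢0))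
    t^q≡t : t ^ q ≡ t
    t^q≡t = begin
      t ^ q              ≡⟨ cong (t ^_) q≡1+3m ⟩
      t * t ^ (3 ℕ.* m)  ≡⟨ cong (t *_) t^3m≡1 ⟩
      t * 1#             ≡⟨ *-identityʳ t ⟩
      t                  ∎
    t≢0 : t ≢ 0#
    t≢0 = x≢0⇒x^n≢0 h (x≢0⇒x^n≢0 (q ℕ.+ 1) x≢0)
    x≡z*t : x ≡ z * t
    x≡z*t = sym (begin
      x^[q-1] ^ h * x^[q+1] ^ h                  ≡⟨ sym (^-distrib-* x^[q-1] x^[q+1] h) ⟩
      (x^[q-1] * x^[q+1]) ^ h                    ≡⟨ cong (_^ h) (sym (^-homo-* x (3 ℕ.* m) (q ℕ.+ 1))) ⟩
      (x ^ (3 ℕ.* m ℕ.+ (q ℕ.+ 1))) ^ h          ≡⟨ ^-assocʳ x (3 ℕ.* m ℕ.+ (q ℕ.+ 1)) h ⟩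
      x ^ ((3 ℕ.* m ℕ.+ (q ℕ.+ 1)) ℕ.* h)        ≡⟨ cong (x ^_) ([3m+[q+1]]*h≡q*q m h q≡1+3m (_∣_.equality 2∣q)) ⟩
      x ^ (q ℕ.* q)                              ≡⟨ cong (x ^_) (sym size≡q*q) ⟩
      x ^ size                                   ≡⟨ x^size≡x x ⟩
      x                                          ∎)

  u∈μ⇒u^k≡u^[k%[q+1]] : ∀ {u} → InMu u → ∀ k → u ^ k ≡ u ^ (k % suc q)
  u∈μ⇒u^k≡u^[k%[q+1]] {u} u∈μ k = begin
    u ^ k                                   ≡⟨ cong (u ^_) (m≡m%n+[m/n]*n k (suc q)) ⟩
    u ^ (k % suc q ℕ.+ k / suc q ℕ.* suc q)  ≡⟨ cong (λ n → u ^ (k % suc q ℕ.+ n)) (ℕ.*-comm (k / suc q) (suc q)) ⟩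
    u ^ (k % suc q ℕ.+ suc q ℕ.* (k / suc q)) ≡⟨ x^n≡1⇒x^[r+n*k]≡x^r (suc q) (k % suc q) (k / suc q) u^[1+q]≡1 ⟩
    u ^ (k % suc q)                         ∎
    where
    u^[1+q]≡1 : u ^ suc q ≡ 1#
    u^[1+q]≡1 = trans (cong (u ^_) (ℕ.+-comm 1 q)) u∈μ

  x≢0⇒x∈uⁱFq* : ∀ {u} → IsGenerator u → ∀ {x} → x ≢ 0# → ∃₂ λ i t → i ℕ.≤ q × InFqStar t × x ≡ u ^ i * t
  x≢0⇒x∈uⁱFq* {u} (u∈μ , generates) x≢0 with x≢0⇒x∈μ*Fq* x≢0
  ... | z , t , z∈μ , t∈Fq* , x≡z*t with generates z z∈μ
  ... | k , z≡u^k = k % suc q , t , ℕ.s≤s⁻¹ (m%n<n k (suc q)) , t∈Fq* ,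
                    trans x≡z*t (cong (_* t) (trans z≡u^k (u∈μ⇒u^k≡u^[k%[q+1]] u∈μ k)))

  traceSum[0]≡0 : ∀ j → traceSum j 0# ≡ 0#
  traceSum[0]≡0 zero    = refl
  traceSum[0]≡0 (suc j) = trans (cong₂ _+_ (traceSum[0]≡0 j) (0^n≡0 (2 ℕ.^ j) {{ℕ.m^n≢0 2 j}})) (+-identityʳ 0#)

  g≗f : ∀ τ → (∀ y → τ (σ y) ≡ y) → ∀ u → IsGenerator u → ∀ α g → IsG u α g → ∀ x → g x ≡ f τ α x
  g≗f τ τ∘σ≗id u u-gen α g (g[0]≡0 , g-on-coset) x with x ≟ 0#
  ... | yes refl = begin
    g 0#               ≡⟨ g[0]≡0 ⟩
    0#                 ≡⟨ sym (traceSum[0]≡0 (2 ℕ.* e)) ⟩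
    Tr 0#              ≡⟨ cong Tr (sym (zeroʳ α)) ⟩
    Tr (α * 0#)        ≡⟨ cong (λ y → Tr (α * y)) (sym (0^n≡0 3)) ⟩
    Tr (α * 0# ^ 3)    ≡⟨ cong (λ y → Tr (α * y ^ 3)) (sym τ[0]≡0) ⟩
    Tr (α * τ 0# ^ 3)  ∎
    where
    τ[0]≡0 : τ 0# ≡ 0#
    τ[0]≡0 = trans (cong τ (sym σ[0]≡0)) (τ∘σ≗id 0#)
  ... | no x≢0 with x≢0⇒x∈uⁱFq* u-gen x≢0
  ...   | i , t , i≤q , t∈Fq* , refl = begin
    g (u ^ i * t)
      ≡⟨ g-on-coset i i≤q t t∈Fq* ⟩
    Tr (α * (u ^ (6 ℕ.* i) ÷ den (u ^ (2 ℕ.* i)) ^ 3) * (z * t) ^ 3)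
      ≡⟨ cong₂ (λ a b → Tr (α * (a ÷ den b ^ 3) * (z * t) ^ 3)) u^[6i]≡[z^2]^3 u^[2i]≡z^2 ⟩
    Tr (α * ((z ^ 2) ^ 3 ÷ den (z ^ 2) ^ 3) * (z * t) ^ 3)
      ≡⟨ cong Tr (x*[y^n÷z^n]*w^n≡x*[[y÷z]*w]^n 3 (w∈μ⇒den[w]≢0 z^2∈μ)) ⟩
    Tr (α * ((z ^ 2 ÷ den (z ^ 2)) * (z * t)) ^ 3)
      ≡⟨ cong (λ y → Tr (α * y ^ 3)) (sym (τ[z*t]≡[z^2÷den[z^2]]*[z*t] τ τ∘σ≗id z z∈μ t t∈Fq*)) ⟩
    Tr (α * τ (z * t) ^ 3)
      ∎
    where
    z : Carrier
    z = u ^ i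
    z∈μ : InMu z
    z∈μ = x^n≡1⇒[x^k]^n≡1 i (q ℕ.+ 1) (proj₁ u-gen)
    z^2∈μ : InMu (z ^ 2)
    z^2∈μ = x^n≡1⇒[x^k]^n≡1 2 (q ℕ.+ 1) z∈μ
    u^[2i]≡z^2 : u ^ (2 ℕ.* i) ≡ z ^ 2
    u^[2i]≡z^2 = trans (cong (u ^_) (ℕ.*-comm 2 i)) (sym (^-assocʳ u i 2))
    u^[6i]≡[z^2]^3 : u ^ (6 ℕ.* i) ≡ (z ^ 2) ^ 3
    u^[6i]≡[z^2]^3 = trans (cong (u ^_) (ℕ.*-comm 6 i)) (sym (trans (^-assocʳ z 2 3) (^-assocʳ u i 6)))

theorem5p2 : (e : ℕ) → NonZero e → 2 ∣ e →
    (F : FiniteField) → FiniteField.size F ≡ Setting.q e F ℕ.* Setting.q e F →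
    let open Setting e F in
    (τ : Carrier → Carrier) → IsInverseOfσ τ →
    (∀ z → InMu z → ∀ t → InFqStar t →
       τ (z * t) ≡ (z ^ 2 ÷ (1# + z ^ 2 + (z ^ 2) ⁻¹)) * (z * t))
    ×
    (∀ u → IsGenerator u → ∀ α → InFqStar α → ∀ g → IsG u α g →
       ∀ x → g x ≡ f τ α x)
theorem5p2 (suc e) _ (divides k suc[e]≡k*2) F size≡q*q τ (τ∘σ≗id , _) =
  τ[z*t]≡[z^2÷den[z^2]]*[z*t] τ τ∘σ≗id ,
  λ u u-gen α _ → g≗f τ τ∘σ≗id u u-gen α
  where
  m : ℕ
  m = proj₁ (4^k≡1+3m k)
  q≡1+3m : 2 ℕ.^ suc e ≡ 1 ℕ.+ 3 ℕ.* m
  q≡1+3m = trans (cong (2 ℕ.^_) suc[e]≡k*2) (proj₂ (4^k≡1+3m k))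
  open Cosets (suc e) F size≡q*q m q≡1+3m (divides (2 ℕ.^ e) (ℕ.*-comm 2 (2 ℕ.^ e)))
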